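{- Let $m,n>0$, $T=\{0,1\}$, and $L=\{H^{p(t)}_t, V^{q(t)}_t\mid t\in T\}$ where $p(t),q(t)\in\{2,3,4,\ldots\}\cup\{\infty\}$ for all $t\in T$. For every tiling $f:G_{m,n}\to T$, the algorithm $\mathcal{A}$ described below applied to $f$ outputs an $L$-dappled tiling; moreover, if $f$ is already $L$-dappled, the output is $f$ itself. In other words, $\mathcal{A}$ defines a retraction from the set of tilings of $G_{m,n}$ onto the set of $L$-dappled tilings of $G_{m,n}$.
   Context: $G_{m,n}=\{(i,j)\in\mathbb{Z}^2\mid 0\le i<m,\ 0\le j<n\}$; a tiling is a function $G_{m,n}\to T$. For $p>1$, $t\in T$ and a tiling $g$, we say $g$ violates $H^p_t$ at $(i,j)$ if $i\ge p$ and $g(i,j)=g(i-1,j)=\cdots=g(i-p,j)=t$; $g$ violates $V^q_t$ at $(i,j)$ if $j\ge q$ and $g(i,j)=g(i,j-1)=\cdots=g(i,j-q)=t$ ($H^\infty_t$, $V^\infty_t$ are never violated). A tiling is $L$-dappled if it violates no condition of $L$ at any cell. Algorithm $\mathcal{A}$: set $g\leftarrow f$. For $w=0,1,\ldots,m+n-2$ in turn, and for each cell $(i,j)\in G_{m,n}$ with $i+j=w$ in increasing order of $i$: if $g$ violates some condition of $L$ at $(i,j)$, set $g(i,j)\leftarrow 1-g(i,j)$; if after this $g$ still violates some condition of $L$ at $(i,j)$, then set $g(i,j)\leftarrow g(i-1,j-1)$, and then $g(i-1,j)\leftarrow 1-g(i,j)$ and $g(i,j-1)\leftarrow 1-g(i,j)$.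 After all cells are processed, output $g$. -}

module Defs where

open import Data.Nat using (ℕ; zero; suc; _+_; _∸_; _≤_; _<_; _≡ᵇ_; _<ᵇ_)
open import Data.Bool using (Bool; true; false; not; _∧_; _∨_; if_then_else_)
open import Data.Bool.Properties using () renaming (_≟_ to _≟B_)
open import Data.List using (List; []; _∷_; upTo; concatMap; foldl; filterᵇ; map)
open import Data.Bool.ListAction using (all; any)
open import Data.Unit using (⊤)
open import Data.Product using (_×_; _,_)
open import Data.Empty using (⊥)
open import Relation.Nullary using (¬_)
open import Relation.Nullary.Decidable using (⌊_⌋)
open import Relation.Binary.PropositionalEquality using (_≡_)

-- Tile set T = {0,1} is represented by Bool (0 = false, 1 = true); 1 - t is `not t`.
-- A tiling of G_{m,n} is represented by a function ℕ → ℕ → Bool; only the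
-- values at cells (i , j) with i < m and j < n are relevant.
Tiling : Set
Tiling = ℕ → ℕ → Bool

data Ext : Set where
  fin : ℕ → Ext
  ∞   : Ext

ValidExt : Ext → Set
ValidExt (fin p) = 2 ≤ p
ValidExt ∞       = ⊤

ViolH : Tiling → Ext → Bool → ℕ → ℕ → Set
ViolH g (fin p) t i j = (p ≤ i) × (∀ k → k ≤ p → g (i ∸ k) j ≡ t)
ViolH g ∞       t i j = ⊥

ViolV : Tiling → Ext → Bool → ℕ → ℕ → Set
ViolV g (fin q) t i j = (q ≤ j) × (∀ k → k ≤ q → g i (j ∸ k) ≡ t)
ViolV g ∞       t i j = ⊥

-- The condition set L = {H^{p(t)}_t, V^{q(t)}_t | t ∈ T} is given by p q : Bool → Ext.
-- g is L-dappled on G_{m,n}: it violates no condition of L at any cell of G_{m,n}.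
Dappled : ℕ → ℕ → (p q : Bool → Ext) → Tiling → Set
Dappled m n p q g =
  ∀ i j → i < m → j < n → ∀ t → ¬ ViolH g (p t) t i j × ¬ ViolV g (q t) t i j

eqB : Bool → Bool → Bool
eqB a b = ⌊ a ≟B b ⌋

violHᵇ : Tiling → Ext → Bool → ℕ → ℕ → Bool
violHᵇ g (fin p) t i j = (p <ᵇ suc i) ∧ all (λ k → eqB (g (i ∸ k) j) t) (upTo (suc p))
violHᵇ g ∞       t i j = false

violVᵇ : Tiling → Ext → Bool → ℕ → ℕ → Bool
violVᵇ g (fin q) t i j = (q <ᵇ suc j) ∧ all (λ k → eqB (g i (j ∸ k)) t) (upTo (suc q))
violVᵇ g ∞       t i j = false

violLᵇ : (p q : Bool → Ext) → Tiling → ℕ → ℕ → Bool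
violLᵇ p q g i j =
  any (λ t → violHᵇ g (p t) t i j ∨ violVᵇ g (q t) t i j) (false ∷ true ∷ [])

set : Tiling → ℕ → ℕ → Bool → Tiling
set g a b v x y = if (x ≡ᵇ a) ∧ (y ≡ᵇ b) then v else g x y

step : (p q : Bool → Ext) → Tiling → ℕ × ℕ → Tiling
step p q g (i , j) =
  if violLᵇ p q g i j
  then (if violLᵇ p q g₁ i j then g₄ else g₁)
  else g
  where
  g₁ = set g i j (not (g i j))
  c  = g₁ (i ∸ 1) (j ∸ 1)
  g₂ = set g₁ i j c
  g₃ = set g₂ (i ∸ 1) j (not c)
  g₄ = set g₃ i (j ∸ 1) (not c)

diagonal : ℕ → ℕ → ℕ → List (ℕ × ℕ)
diagonal m n w =
  map (λ i → (i , w ∸ i))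
      (filterᵇ (λ i → (i <ᵇ m) ∧ ((w ∸ i) <ᵇ n)) (upTo (suc w)))

order : ℕ → ℕ → List (ℕ × ℕ)
order m n = concatMap (diagonal m n) (upTo (m + n ∸ 1))

𝒜 : ℕ → ℕ → (p q : Bool → Ext) → Tiling → Tiling
𝒜 m n p q f = foldl (step p q) f (order m n)

-- Cells are processed antidiagonal by antidiagonal, and a violation at a cell only reads
-- cells before it in its own row or column, so changing the cell being processed never spoils
-- an earlier one.  If neither value of the processed cell (i , j) is admissible, then one value
-- completes a run along H and the other a run along V (a run ending at (i , j) cannot survive
-- flipping (i , j)), so g (i-1 , j) = g (i-2 , j) and g (i , j-1) = g (i , j-2).  The repair
-- gives (i , j) the value c of its diagonal neighbour (i-1 , j-1) and the two cells
-- (i-1 , j), (i , j-1) the value not c, which clears (i , j).  A run at an earlier cell through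
-- one of these two cells either already existed, by the two equalities, or also covers
-- (i-1 , j-1), where it meets c next to not c.  Hence after processing (i , j) every cell up to
-- it is admissible; and an admissible cell is left unchanged, which gives the retraction.
module Submission where

open import Defs
open import Data.Bool using (Bool; true; false; not; _∨_; _∧_; T; if_then_else_)
open import Data.Bool.Properties using (T-≡; T-∧; T-∨; not-¬)
open import Data.Bool.ListAction using (all)
open import Data.Empty using (⊥; ⊥-elim)
open import Data.List using ([]; _∷_; upTo; foldl)
open import Data.List.Membership.Propositional using (_∈_; lose)
open import Data.List.Membership.Propositional.Properties
  using (∈-upTo⁺; ∈-upTo⁻; ∈-map⁺; ∈-map⁻; ∈-filter⁺; ∈-filter⁻; ∈-concatMap⁺; ∈-concatMap⁻)
open import Data.List.Relation.Unary.All as All using (All; []; _∷_)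
open import Data.List.Relation.Unary.All.Properties using (all⁺; all⁻) renaming (map⁺ to All-map⁺)
open import Data.List.Relation.Unary.Any using (here; there; satisfied)
open import Data.List.Relation.Unary.Any.Properties using (any⁺; any⁻)
open import Data.List.Relation.Unary.AllPairs using (AllPairs; []; _∷_)
import Data.List.Relation.Unary.AllPairs.Properties as AllPairs
open import Data.Nat using (ℕ; suc; pred; _+_; _∸_; _≤_; _<_; _≡ᵇ_; _<ᵇ_; z≤n; s≤s)
open import Data.Nat.Properties
open import Data.Product using (∃; _×_; _,_; proj₁; proj₂; swap)
open import Data.Product.Properties using (,-injective)
open import Data.Sum using (_⊎_; inj₁; inj₂; map₂)
open import Function using (_∘_)
open import Function.Bundles using (_⇔_; mk⇔; Equivalence)
open import Relation.Nullary using (¬_)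
open import Relation.Nullary.Decidable using (toWitness; fromWitness; T?)
open import Relation.Binary.PropositionalEquality

private variable
  p q : Bool → Ext
  e : Ext
  c t : Bool
  g g' : Tiling
  a b i j k u v x y x₀ y₀ : ℕ

Clean : (p q : Bool → Ext) → Tiling → ℕ → ℕ → Set
Clean p q g i j = ∀ t → ¬ ViolH g (p t) t i j × ¬ ViolV g (q t) t i j

CleanAt : (p q : Bool → Ext) → Tiling → ℕ × ℕ → Set
CleanAt p q g (i , j) = Clean p q g i j

Violates : (p q : Bool → Ext) → Tiling → ℕ → ℕ → Set
Violates p q g i j = ∃ λ t → ViolH g (p t) t i j ⊎ ViolV g (q t) t i j

Clean⇒¬Violates : Clean p q g i j → ¬ Violates p q g i j
Clean⇒¬Violates clean (t , inj₁ h) = proj₁ (clean t) h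
Clean⇒¬Violates clean (t , inj₂ v) = proj₂ (clean t) v

¬Violates⇒Clean : ¬ Violates p q g i j → Clean p q g i j
¬Violates⇒Clean ¬viol t = (λ h → ¬viol (t , inj₁ h)) , (λ v → ¬viol (t , inj₂ v))

run⇔ : ∀ (r : ℕ → Bool) t p i →
  T ((p <ᵇ suc i) ∧ all (λ k → eqB (r k) t) (upTo (suc p))) ⇔ (p ≤ i × (∀ k → k ≤ p → r k ≡ t))
run⇔ r t p i = mk⇔ to from
  where
  to : T ((p <ᵇ suc i) ∧ all (λ k → eqB (r k) t) (upTo (suc p))) → p ≤ i × (∀ k → k ≤ p → r k ≡ t)
  to hyp with p<1+i , eqs ← Equivalence.to T-∧ hyp =
    ≤-pred (<ᵇ⇒< p (suc i) p<1+i) ,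
    λ k k≤p → toWitness (All.lookup (all⁺ _ (upTo (suc p)) eqs) (∈-upTo⁺ (s≤s k≤p)))
  from : p ≤ i × (∀ k → k ≤ p → r k ≡ t) → T ((p <ᵇ suc i) ∧ all (λ k → eqB (r k) t) (upTo (suc p)))
  from (p≤i , eqs) = Equivalence.from T-∧
    (<⇒<ᵇ (s≤s p≤i) , all⁻ _ (All.tabulate λ k∈ → fromWitness (eqs _ (≤-pred (∈-upTo⁻ k∈)))))

violHᵇ⇔ViolH : ∀ g e t i j → T (violHᵇ g e t i j) ⇔ ViolH g e t i j
violHᵇ⇔ViolH g (fin p) t i j = run⇔ (λ k → g (i ∸ k) j) t p i
violHᵇ⇔ViolH g ∞ t i j = mk⇔ (λ ()) (λ ())

violVᵇ⇔ViolV : ∀ g e t i j → T (violVᵇ g e t i j) ⇔ ViolV g e t i j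
violVᵇ⇔ViolV g (fin q) t i j = run⇔ (λ k → g i (j ∸ k)) t q j
violVᵇ⇔ViolV g ∞ t i j = mk⇔ (λ ()) (λ ())

violLᵇ⇔Violates : ∀ p q g i j → T (violLᵇ p q g i j) ⇔ Violates p q g i j
violLᵇ⇔Violates p q g i j = mk⇔ to from
  where
  test : Bool → Bool
  test t = violHᵇ g (p t) t i j ∨ violVᵇ g (q t) t i j
  test-sound : ∀ t → T (test t) → ViolH g (p t) t i j ⊎ ViolV g (q t) t i j
  test-sound t hyp with Equivalence.to T-∨ hyp
  ... | inj₁ h = inj₁ (Equivalence.to (violHᵇ⇔ViolH g (p t) t i j) h)
  ... | inj₂ v = inj₂ (Equivalence.to (violVᵇ⇔ViolV g (q t) t i j) v)
  test-complete : ∀ t → ViolH g (p t) t i j ⊎ ViolV g (q t) t i j → T (test t)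
  test-complete t (inj₁ h) = Equivalence.from T-∨ (inj₁ (Equivalence.from (violHᵇ⇔ViolH g (p t) t i j) h))
  test-complete t (inj₂ v) = Equivalence.from T-∨ (inj₂ (Equivalence.from (violVᵇ⇔ViolV g (q t) t i j) v))
  to : T (violLᵇ p q g i j) → Violates p q g i j
  to hyp with any⁻ test (false ∷ true ∷ []) hyp
  ... | here h = false , test-sound false h
  ... | there (here h) = true , test-sound true h
  from : Violates p q g i j → T (violLᵇ p q g i j)
  from (false , viol) = any⁺ {xs = false ∷ true ∷ []} test (here (test-complete false viol))
  from (true , viol) = any⁺ {xs = false ∷ true ∷ []} test (there (here (test-complete true viol)))

violLᵇ≡true⇒Violates : ∀ p q g i j → violLᵇ p q g i j ≡ true → Violates p q g i j
violLᵇ≡true⇒Violates p q g i j = Equivalence.to (violLᵇ⇔Violates p q g i j) ∘ Equivalence.from T-≡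

violLᵇ≡false⇒Clean : ∀ p q g i j → violLᵇ p q g i j ≡ false → Clean p q g i j
violLᵇ≡false⇒Clean p q g i j passes =
  ¬Violates⇒Clean (subst T passes ∘ Equivalence.from (violLᵇ⇔Violates p q g i j))

Cell : Set
Cell = ℕ × ℕ

_≺_ : Cell → Cell → Set
(a , b) ≺ (i , j) = a + b < i + j ⊎ (a + b ≡ i + j × a < i)

inGridᵇ : ℕ → ℕ → ℕ → ℕ → Bool
inGridᵇ m n w i = (i <ᵇ m) ∧ (w ∸ i <ᵇ n)

∈-diagonal⁻ : ∀ m n w {c} → c ∈ diagonal m n w →
  proj₁ c + proj₂ c ≡ w × proj₁ c < m × proj₂ c < n
∈-diagonal⁻ m n w c∈ with i , i∈ , refl ← ∈-map⁻ (λ i → (i , w ∸ i)) c∈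
  with i∈upTo , inside ← ∈-filter⁻ (T? ∘ inGridᵇ m n w) {xs = upTo (suc w)} i∈
  with i<m , w∸i<n ← Equivalence.to T-∧ inside =
  m+[n∸m]≡n (≤-pred (∈-upTo⁻ i∈upTo)) , <ᵇ⇒< i m i<m , <ᵇ⇒< (w ∸ i) n w∸i<n

∈-diagonal⁺ : ∀ {m n i j} → i < m → j < n → (i , j) ∈ diagonal m n (i + j)
∈-diagonal⁺ {m} {n} {i} {j} i<m j<n =
  subst (λ z → (i , z) ∈ diagonal m n (i + j)) (m+n∸m≡n i j)
    (∈-map⁺ (λ k → (k , i + j ∸ k))
      (∈-filter⁺ (T? ∘ inGridᵇ m n (i + j)) (∈-upTo⁺ (s≤s (m≤m+n i j)))
        (Equivalence.from T-∧ (<⇒<ᵇ i<m , subst (λ z → T (z <ᵇ n)) (sym (m+n∸m≡n i j)) (<⇒<ᵇ j<n)))))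

∈-order⁻ : ∀ m n {c} → c ∈ order m n → proj₁ c < m × proj₂ c < n
∈-order⁻ m n c∈ with w , c∈d ← satisfied (∈-concatMap⁻ (diagonal m n) {xs = upTo (m + n ∸ 1)} c∈) =
  proj₂ (∈-diagonal⁻ m n w c∈d)

∈-order⁺ : ∀ {m n i j} → i < m → j < n → (i , j) ∈ order m n
∈-order⁺ {suc m} {suc n} (s≤s i≤m) j<n =
  ∈-concatMap⁺ (diagonal (suc m) (suc n)) (lose (∈-upTo⁺ (+-mono-≤-< i≤m j<n)) (∈-diagonal⁺ (s≤s i≤m) j<n))

diagonal-sorted : ∀ m n w → AllPairs _≺_ (diagonal m n w)
diagonal-sorted m n w =
  AllPairs.map⁺ (AllPairs.filter⁺ (T? ∘ inGridᵇ m n w) (AllPairs.applyUpTo⁺₁ (λ i → i) (suc w) along))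
  where
  along : ∀ {i j} → i < j → j < suc w → (i , w ∸ i) ≺ (j , w ∸ j)
  along i<j (s≤s j≤w) = inj₂ (trans (m+[n∸m]≡n (≤-trans (<⇒≤ i<j) j≤w)) (sym (m+[n∸m]≡n j≤w)) , i<j)

order-sorted : ∀ m n → AllPairs _≺_ (order m n)
order-sorted m n =
  AllPairs.concat⁺ (All-map⁺ (All.universal (diagonal-sorted m n) _))
    (AllPairs.map⁺ (AllPairs.applyUpTo⁺₁ (λ w → w) (m + n ∸ 1) across))
  where
  across : ∀ {v w} → v < w → w < m + n ∸ 1 → All (λ c → All (c ≺_) (diagonal m n w)) (diagonal m n v)
  across v<w _ = All.tabulate λ c∈ → All.tabulate λ d∈ →
    inj₁ (subst₂ _<_ (sym (proj₁ (∈-diagonal⁻ m n _ c∈))) (sym (proj₁ (∈-diagonal⁻ m n _ d∈))) v<w)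

module _ {C X : Set} (s : X → C → X) {Good : X → C → Set} where

  foldl-preserves : ∀ {_<_ : C → C → Set} → (∀ x c d → d < c → Good x d → Good (s x c) d) →
    ∀ cs x d → All (d <_) cs → Good x d → Good (foldl s x cs) d
  foldl-preserves keeps [] x d [] good = good
  foldl-preserves keeps (c ∷ cs) x d (d<c ∷ d<cs) good =
    foldl-preserves keeps cs (s x c) d d<cs (keeps x c d d<c good)

  foldl-establishes : ∀ {_<_ : C → C → Set} → (∀ x c → Good (s x c) c) →
    (∀ x c d → d < c → Good x d → Good (s x c) d) →
    ∀ cs x → AllPairs _<_ cs → ∀ {c} → c ∈ cs → Good (foldl s x cs) c
  foldl-establishes makes keeps (c ∷ cs) x (c<cs ∷ _) (here refl) =
    foldl-preserves keeps cs (s x c) c c<cs (makes x c)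
  foldl-establishes makes keeps (c ∷ cs) x (_ ∷ sorted) (there c∈) =
    foldl-establishes makes keeps cs (s x c) sorted c∈

  foldl-fixed : (∀ x c → Good x c → s x c ≡ x) → ∀ cs x → All (Good x) cs → foldl s x cs ≡ x
  foldl-fixed fixes [] x [] = refl
  foldl-fixed fixes (c ∷ cs) x (good ∷ goods) rewrite fixes x c good = foldl-fixed fixes cs x goods

set-cases : ∀ g a b c u v → set g a b c u v ≡ g u v ⊎ (u , v) ≡ (a , b)
set-cases g a b c u v with (u ≡ᵇ a) ∧ (v ≡ᵇ b) in hit
... | false = inj₁ refl
... | true with u≡ᵇa , v≡ᵇb ← Equivalence.to T-∧ (subst T (sym hit) _) =
  inj₂ (cong₂ _,_ (≡ᵇ⇒≡ u a u≡ᵇa) (≡ᵇ⇒≡ v b v≡ᵇb))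

set-≢ : ∀ g a b c u v → (u , v) ≢ (a , b) → set g a b c u v ≡ g u v
set-≢ g a b c u v ne with set-cases g a b c u v
... | inj₁ same = same
... | inj₂ hit = ⊥-elim (ne hit)

set-≡ : ∀ g a b c → set g a b c a b ≡ c
set-≡ g a b c rewrite Equivalence.to T-≡ (≡⇒≡ᵇ a a refl) | Equivalence.to T-≡ (≡⇒≡ᵇ b b refl) = refl

flipAt : Tiling → ℕ → ℕ → Tiling
flipAt g i j = set g i j (not (g i j))

repairAt : Tiling → ℕ → ℕ → Tiling
repairAt g i j = set (set (set g₁ i j corner) (i ∸ 1) j (not corner)) i (j ∸ 1) (not corner)
  where
  g₁ = flipAt g i j
  corner = g₁ (i ∸ 1) (j ∸ 1)

data StepView (p q : Bool → Ext) (g : Tiling) (i j : ℕ) : Tiling → Set where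
  kept     : Clean p q g i j → StepView p q g i j g
  flipped  : Violates p q g i j → Clean p q (flipAt g i j) i j → StepView p q g i j (flipAt g i j)
  repaired : Violates p q g i j → Violates p q (flipAt g i j) i j → StepView p q g i j (repairAt g i j)

stepView : ∀ p q g i j → StepView p q g i j (step p q g (i , j))
stepView p q g i j = view (violLᵇ p q g i j) (violLᵇ p q (flipAt g i j) i j) refl refl
  where
  view : ∀ b₁ b₂ → violLᵇ p q g i j ≡ b₁ → violLᵇ p q (flipAt g i j) i j ≡ b₂ →
    StepView p q g i j (if b₁ then (if b₂ then repairAt g i j else flipAt g i j) else g)
  view false _ passes _ = kept (violLᵇ≡false⇒Clean p q g i j passes)
  view true false fails passes =
    flipped (violLᵇ≡true⇒Violates p q g i j fails) (violLᵇ≡false⇒Clean p q (flipAt g i j) i j passes)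
  view true true fails fails′ =
    repaired (violLᵇ≡true⇒Violates p q g i j fails) (violLᵇ≡true⇒Violates p q (flipAt g i j) i j fails′)

step-fixes-Clean : ∀ g c → CleanAt p q g c → step p q g c ≡ g
step-fixes-Clean {p} {q} g (i , j) clean with step p q g (i , j) | stepView p q g i j
... | _ | kept _ = refl
... | _ | flipped fails _ = ⊥-elim (Clean⇒¬Violates clean fails)
... | _ | repaired fails _ = ⊥-elim (Clean⇒¬Violates clean fails)

-- Weaker than the sweep order, but invariant under transposition, so that column runs can be
-- handled as row runs of the transposed tiling.
Earlier : Cell → Cell → Set
Earlier (a , b) (i , j) = a + b ≤ i + j × (a , b) ≢ (i , j)

≺⇒Earlier : ∀ {c d} → c ≺ d → Earlier c d
≺⇒Earlier (inj₁ lt) = <⇒≤ lt , λ { refl → <-irrefl refl lt }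
≺⇒Earlier (inj₂ (eq , a<i)) = ≤-reflexive eq , λ { refl → <-irrefl refl a<i }

_ᵀ : Tiling → Tiling
(g ᵀ) x y = g y x

Earlier-ᵀ : Earlier (a , b) (i , j) → Earlier (b , a) (j , i)
Earlier-ᵀ {a} {b} {i} {j} (le , ne) = subst₂ _≤_ (+-comm a b) (+-comm i j) le , ne ∘ cong swap

ViolV⇒ViolHᵀ : ViolV g e t i j → ViolH (g ᵀ) e t j i
ViolV⇒ViolHᵀ {e = fin q} viol = viol

ViolHᵀ⇒ViolV : ViolH (g ᵀ) e t j i → ViolV g e t i j
ViolHᵀ⇒ViolV {e = fin q} viol = viol

m∸n≡o∧m≤o⇒m≡o : a ∸ k ≡ u → a ≤ u → a ≡ u
m∸n≡o∧m≤o⇒m≡o {a} {k} refl a≤u = ≤-antisym a≤u (m∸n≤m a k)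

m∸n≡o∧m≤1+o⇒n≤1 : k ≤ a → a ∸ k ≡ u → a ≤ suc u → k ≤ 1
m∸n≡o∧m≤1+o⇒n≤1 {k} {a} {u} k≤a eq a≤1+u = +-cancelˡ-≤ u k 1 (begin
  u + k        ≡⟨ cong (_+ k) eq ⟨
  a ∸ k + k    ≡⟨ m∸n+n≡m k≤a ⟩
  a            ≤⟨ a≤1+u ⟩
  suc u        ≡⟨ +-comm 1 u ⟩
  u + 1        ∎)
  where open ≤-Reasoning

Earlier⇒row-avoids : Earlier (a , b) (i , j) → ∀ k → (a ∸ k , b) ≢ (i , j)
Earlier⇒row-avoids {a} {b} {i} (le , ne) k eq with a∸k≡i , refl ← ,-injective eq =
  ne (cong (_, b) (m∸n≡o∧m≤o⇒m≡o {k = k} a∸k≡i (+-cancelʳ-≤ b a i le)))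

Clean-pullback : (∀ {t} → ViolH g' (p t) t a b → ViolH g (p t) t a b) →
  (∀ {t} → ViolV g' (q t) t a b → ViolV g (q t) t a b) → Clean p q g a b → Clean p q g' a b
Clean-pullback pullH pullV clean t = proj₁ (clean t) ∘ pullH , proj₂ (clean t) ∘ pullV

AgreeOff : Tiling → Tiling → ℕ → ℕ → Set
AgreeOff g' g i j = ∀ {x y} → (x , y) ≢ (i , j) → g' x y ≡ g x y

AgreeOff-ᵀ : AgreeOff g' g i j → AgreeOff (g' ᵀ) (g ᵀ) j i
AgreeOff-ᵀ agree ne = agree (ne ∘ cong swap)

flipAt-AgreeOff : ∀ g i j → AgreeOff (flipAt g i j) g i j
flipAt-AgreeOff g i j {u} {v} = set-≢ g i j _ u v

ViolH-pullback : AgreeOff g' g i j → Earlier (a , b) (i , j) → ViolH g' e t a b → ViolH g e t a b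
ViolH-pullback {e = fin p} agree ear (p≤a , run) =
  p≤a , λ k k≤p → trans (sym (agree (Earlier⇒row-avoids ear k))) (run k k≤p)

ViolV-pullback : AgreeOff g' g i j → Earlier (a , b) (i , j) → ViolV g' e t a b → ViolV g e t a b
ViolV-pullback agree ear =
  ViolHᵀ⇒ViolV ∘ ViolH-pullback (AgreeOff-ᵀ agree) (Earlier-ᵀ ear) ∘ ViolV⇒ViolHᵀ

opposite-values : c ≡ t → not c ≡ t → ⊥
opposite-values refl n≡c = not-¬ refl (sym n≡c)

data RunH (g : Tiling) : ℕ → ℕ → Set where
  run₃ : ∀ {i₀ j} → g (suc (suc i₀)) j ≡ g (suc i₀) j → g (suc i₀) j ≡ g i₀ j → RunH g (suc (suc i₀)) j

ViolH⇒RunH : ValidExt e → ViolH g e t i j → RunH g i j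
ViolH⇒RunH {e = fin p} 2≤p (p≤i , run) with ≤-trans 2≤p p≤i
... | s≤s (s≤s _) = run₃ (trans (run 0 z≤n) (sym (run 1 1≤p))) (trans (run 1 1≤p) (sym (run 2 2≤p)))
  where
  1≤p = ≤-trans (s≤s z≤n) 2≤p

flip-breaks-RunH : AgreeOff g' g i j → g' i j ≡ not (g i j) → RunH g i j → ¬ RunH g' i j
flip-breaks-RunH agree flipped-value (run₃ before _) (run₃ after _) =
  opposite-values before (trans (sym flipped-value) (trans after (agree (λ ()))))

data Cornered (g : Tiling) : ℕ → ℕ → Set where
  cornered : ∀ {i₀ j₀} → g (suc i₀) (suc (suc j₀)) ≡ g i₀ (suc (suc j₀)) →
    g (suc (suc i₀)) (suc j₀) ≡ g (suc (suc i₀)) j₀ → Cornered g (suc (suc i₀)) (suc (suc j₀))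

flip-fails⇒Cornered : ∀ g i j → RunH g i j ⊎ RunH (g ᵀ) j i →
  RunH (flipAt g i j) i j ⊎ RunH (flipAt g i j ᵀ) j i → Cornered g i j
flip-fails⇒Cornered g i j (inj₁ h) (inj₁ h′) =
  ⊥-elim (flip-breaks-RunH (flipAt-AgreeOff g i j) (set-≡ g i j _) h h′)
flip-fails⇒Cornered g i j (inj₂ v) (inj₂ v′) =
  ⊥-elim (flip-breaks-RunH (AgreeOff-ᵀ (flipAt-AgreeOff g i j)) (set-≡ g i j _) v v′)
flip-fails⇒Cornered g i j (inj₁ (run₃ _ h)) (inj₂ (run₃ _ v′)) =
  cornered h (trans (sym (flipAt-AgreeOff g i j (λ ()))) (trans v′ (flipAt-AgreeOff g i j (λ ()))))
flip-fails⇒Cornered g i j (inj₂ (run₃ _ v)) (inj₁ (run₃ _ h′)) =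
  cornered (trans (sym (flipAt-AgreeOff g i j (λ ()))) (trans h′ (flipAt-AgreeOff g i j (λ ())))) v

data Touched (x y : ℕ) : ℕ → ℕ → Set where
  centre : Touched x y (suc x) (suc y)
  h-pred : Touched x y x (suc y)
  v-pred : Touched x y (suc x) y

Touched-ᵀ : Touched x y u v → Touched y x v u
Touched-ᵀ centre = centre
Touched-ᵀ h-pred = v-pred
Touched-ᵀ v-pred = h-pred

record Repaired (g g' : Tiling) (x y : ℕ) : Set where
  field
    touched-only : ∀ u v → g' u v ≡ g u v ⊎ Touched x y u v
    at-centre    : g' (suc x) (suc y) ≡ g x y
    at-h-pred    : g' x (suc y) ≡ not (g x y)
    at-v-pred    : g' (suc x) y ≡ not (g x y)

  untouched : ¬ Touched x y u v → g' u v ≡ g u v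
  untouched {u} {v} ¬touched with touched-only u v
  ... | inj₁ same = same
  ... | inj₂ touched = ⊥-elim (¬touched touched)

Repaired-ᵀ : Repaired g g' x y → Repaired (g ᵀ) (g' ᵀ) y x
Repaired-ᵀ r = record
  { touched-only = λ u v → map₂ Touched-ᵀ (touched-only v u)
  ; at-centre    = at-centre
  ; at-h-pred    = at-v-pred
  ; at-v-pred    = at-h-pred
  }
  where open Repaired r

repairAt-Repaired : ∀ g x y → Repaired g (repairAt g (suc x) (suc y)) x y
repairAt-Repaired g x y = record
  { touched-only = touched-only
  ; at-centre = begin
      g₃′ (suc x) (suc y)   ≡⟨ set-≢ g₃ (suc x) y _ (suc x) (suc y) (λ ()) ⟩
      g₃ (suc x) (suc y)    ≡⟨ set-≢ g₂ x (suc y) _ (suc x) (suc y) (λ ()) ⟩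
      g₂ (suc x) (suc y)    ≡⟨ set-≡ g₁ (suc x) (suc y) corner ⟩
      corner                ≡⟨ corner≡ ⟩
      g x y                 ∎
  ; at-h-pred = trans (set-≢ g₃ (suc x) y _ x (suc y) (λ ())) (trans (set-≡ g₂ x (suc y) (not corner)) (cong not corner≡))
  ; at-v-pred = trans (set-≡ g₃ (suc x) y (not corner)) (cong not corner≡)
  }
  where
  open ≡-Reasoning
  g₁ = flipAt g (suc x) (suc y)
  corner = g₁ x y
  g₂ = set g₁ (suc x) (suc y) corner
  g₃ = set g₂ x (suc y) (not corner)
  g₃′ = set g₃ (suc x) y (not corner)
  corner≡ : corner ≡ g x y
  corner≡ = set-≢ g (suc x) (suc y) _ x y (λ ())
  touched-only : ∀ u v → g₃′ u v ≡ g u v ⊎ Touched x y u v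
  touched-only u v with set-cases g₃ (suc x) y (not corner) u v
  ... | inj₂ refl = inj₂ v-pred
  ... | inj₁ e₃ with set-cases g₂ x (suc y) (not corner) u v
  ...   | inj₂ refl = inj₂ h-pred
  ...   | inj₁ e₂ with set-cases g₁ (suc x) (suc y) corner u v
  ...     | inj₂ refl = inj₂ centre
  ...     | inj₁ e₁ with set-cases g (suc x) (suc y) (not (g (suc x) (suc y))) u v
  ...       | inj₂ refl = inj₂ centre
  ...       | inj₁ e₀ = inj₁ (trans e₃ (trans e₂ (trans e₁ e₀)))

repaired-centre-¬ViolH : Repaired g g' x y → ValidExt e → ¬ ViolH g' e t (suc x) (suc y)
repaired-centre-¬ViolH {e = fin p} r 2≤p (_ , run) =
  opposite-values (trans (sym at-centre) (run 0 z≤n)) (trans (sym at-h-pred) (run 1 (≤-trans (s≤s z≤n) 2≤p)))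
  where open Repaired r

repaired-centre-Clean : (∀ t → ValidExt (p t)) → (∀ t → ValidExt (q t)) →
  Repaired g g' x y → Clean p q g' (suc x) (suc y)
repaired-centre-Clean valid-p valid-q r t =
  repaired-centre-¬ViolH r (valid-p t) ,
  repaired-centre-¬ViolH (Repaired-ᵀ r) (valid-q t) ∘ ViolV⇒ViolHᵀ

-- A run through the H-predecessor ends there, and its cell was already t by the hypothesis on g;
-- a run through the V-predecessor ends at most one step further, so it also covers the corner.
repaired-run-cells : Repaired g g' (suc x₀) y → g (suc x₀) (suc y) ≡ g x₀ (suc y) →
  ∀ {a b} → Earlier (a , b) (suc (suc x₀) , suc y) → ∀ {p} → 2 ≤ p → p ≤ a →
  (∀ k → k ≤ p → g' (a ∸ k) b ≡ t) → ∀ k → k ≤ p → g (a ∸ k) b ≡ t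
repaired-run-cells {g = g} {g' = g'} {x₀ = x₀} {y = y} {t = t} r fact {a} {b} ear@(le , ne) 2≤p p≤a run k k≤p
  with a ∸ k in a∸k≡u | Repaired.touched-only r (a ∸ k) b
... | u | inj₁ same = trans (sym same) (subst (λ u → g' u b ≡ t) a∸k≡u (run k k≤p))
... | _ | inj₂ centre = ⊥-elim (Earlier⇒row-avoids ear k (cong (_, b) a∸k≡u))
... | _ | inj₂ h-pred = begin
  g (suc x₀) (suc y)   ≡⟨ fact ⟩
  g x₀ (suc y)         ≡⟨ untouched (λ ()) ⟨
  g' x₀ (suc y)        ≡⟨ subst (λ a → g' (a ∸ 1) (suc y) ≡ t) a≡1+x₀ (run 1 (≤-trans (s≤s z≤n) 2≤p)) ⟩
  t                    ∎
  where
  open Repaired r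
  open ≡-Reasoning
  a≤1+x₀ : a ≤ suc x₀
  a≤1+x₀ = ≤-pred (≤∧≢⇒< (+-cancelʳ-≤ (suc y) a (suc (suc x₀)) le) (ne ∘ cong (_, suc y)))
  a≡1+x₀ : a ≡ suc x₀
  a≡1+x₀ = m∸n≡o∧m≤o⇒m≡o {k = k} a∸k≡u a≤1+x₀
... | _ | inj₂ v-pred =
  ⊥-elim (opposite-values corner-is-t (trans (sym at-v-pred) (subst (λ u → g' u y ≡ t) a∸k≡u (run k k≤p))))
  where
  open Repaired r
  k≤1 : k ≤ 1
  k≤1 = m∸n≡o∧m≤1+o⇒n≤1 (≤-trans k≤p p≤a) a∸k≡u
          (+-cancelʳ-≤ y a (suc (suc (suc x₀))) (subst (a + y ≤_) (+-suc (suc (suc x₀)) y) le))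
  a∸1+k≡1+x₀ : a ∸ suc k ≡ suc x₀
  a∸1+k≡1+x₀ = trans (sym (pred[m∸n]≡m∸[1+n] a k)) (cong pred a∸k≡u)
  corner-is-t : g (suc x₀) y ≡ t
  corner-is-t = trans (sym (untouched (λ ())))
    (subst (λ u → g' u y ≡ t) a∸1+k≡1+x₀ (run (suc k) (≤-trans (s≤s k≤1) 2≤p)))

repaired-ViolH-pullback : Repaired g g' (suc x₀) y → g (suc x₀) (suc y) ≡ g x₀ (suc y) →
  Earlier (a , b) (suc (suc x₀) , suc y) → ValidExt e → ViolH g' e t a b → ViolH g e t a b
repaired-ViolH-pullback {e = fin p} r fact ear 2≤p (p≤a , run) =
  p≤a , repaired-run-cells r fact ear 2≤p p≤a run

repaired-ViolV-pullback : Repaired g g' x (suc y₀) → g (suc x) (suc y₀) ≡ g (suc x) y₀ →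
  Earlier (a , b) (suc x , suc (suc y₀)) → ValidExt e → ViolV g' e t a b → ViolV g e t a b
repaired-ViolV-pullback r fact ear valid =
  ViolHᵀ⇒ViolV ∘ repaired-ViolH-pullback (Repaired-ᵀ r) fact (Earlier-ᵀ ear) valid ∘ ViolV⇒ViolHᵀ

module _ {p q : Bool → Ext} (valid-p : ∀ t → ValidExt (p t)) (valid-q : ∀ t → ValidExt (q t)) where

  Violates⇒Run : Violates p q g i j → RunH g i j ⊎ RunH (g ᵀ) j i
  Violates⇒Run (t , inj₁ h) = inj₁ (ViolH⇒RunH (valid-p t) h)
  Violates⇒Run (t , inj₂ v) = inj₂ (ViolH⇒RunH (valid-q t) (ViolV⇒ViolHᵀ v))

  repair-Clean : Cornered g i j → Clean p q (repairAt g i j) i j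
  repair-Clean (cornered _ _) = repaired-centre-Clean valid-p valid-q (repairAt-Repaired _ _ _)

  repair-preserves-Clean : Cornered g i j → Earlier (a , b) (i , j) →
    Clean p q g a b → Clean p q (repairAt g i j) a b
  repair-preserves-Clean (cornered row col) ear =
    Clean-pullback (repaired-ViolH-pullback (repairAt-Repaired _ _ _) row ear (valid-p _))
                   (repaired-ViolV-pullback (repairAt-Repaired _ _ _) col ear (valid-q _))

  step-establishes-Clean : ∀ g c → CleanAt p q (step p q g c) c
  step-establishes-Clean g (i , j) with step p q g (i , j) | stepView p q g i j
  ... | _ | kept clean = clean
  ... | _ | flipped _ clean = clean
  ... | _ | repaired fails fails′ =
    repair-Clean (flip-fails⇒Cornered g i j (Violates⇒Run fails) (Violates⇒Run fails′))

  step-preserves-Clean : ∀ g c d → d ≺ c → CleanAt p q g d → CleanAt p q (step p q g c) d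
  step-preserves-Clean g (i , j) (a , b) d≺c clean with step p q g (i , j) | stepView p q g i j
  ... | _ | kept _ = clean
  ... | _ | flipped _ _ =
    Clean-pullback (ViolH-pullback (flipAt-AgreeOff g i j) (≺⇒Earlier d≺c))
                   (ViolV-pullback (flipAt-AgreeOff g i j) (≺⇒Earlier d≺c)) clean
  ... | _ | repaired fails fails′ =
    repair-preserves-Clean (flip-fails⇒Cornered g i j (Violates⇒Run fails) (Violates⇒Run fails′))
      (≺⇒Earlier d≺c) clean

mainTheorem2 : (m n : ℕ) → 0 < m → 0 < n →
    (p q : Bool → Ext) → (∀ t → ValidExt (p t)) → (∀ t → ValidExt (q t)) →
    (f : Tiling) →
    Dappled m n p q (𝒜 m n p q f) ×
    (Dappled m n p q f → ∀ i j → i < m → j < n → 𝒜 m n p q f i j ≡ f i j)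
mainTheorem2 m n _ _ p q valid-p valid-q f = dappled , retracts
  where
  dappled : Dappled m n p q (𝒜 m n p q f)
  dappled i j i<m j<n =
    foldl-establishes (step p q) (step-establishes-Clean valid-p valid-q) (step-preserves-Clean valid-p valid-q)
      (order m n) f (order-sorted m n) (∈-order⁺ i<m j<n)
  retracts : Dappled m n p q f → ∀ i j → i < m → j < n → 𝒜 m n p q f i j ≡ f i j
  retracts clean i j _ _ = cong (λ g → g i j)
    (foldl-fixed (step p q) step-fixes-Clean (order m n) f
      (All.tabulate λ c∈ → let i<m , j<n = ∈-order⁻ m n c∈ in clean _ _ i<m j<n))
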